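{- If $G$ is a finite nilpotent group which is not a $p$-group (for any prime $p$), then the difference graph $D(G)$ is connected and $\operatorname{diam}(D(G))\leq 4$.
   Context: For a group $G$, the power graph $\mathsf{Pow}(G)$ has vertex set $G$, with distinct $a,b$ adjacent iff $a\in\langle b\rangle$ or $b\in\langle a\rangle$. The enhanced power graph $\mathsf{EPow}(G)$ has vertex set $G$, with distinct $a,b$ adjacent iff $\langle a,b\rangle$ is cyclic. The difference graph $D(G)$ is the graph $\mathsf{EPow}(G)-\mathsf{Pow}(G)$ with all isolated vertices removed; thus $x\sim y$ in $D(G)$ iff $\langle x,y\rangle$ is cyclic, $x\notin\langle y\rangle$ and $y\notin\langle x\rangle$. -}

module Defs where

open import Level using (Level; _⊔_; Lift)
open import Algebra.Bundles using (Group)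
open import Data.Nat using (ℕ; zero; suc)
open import Data.Fin using (Fin)
open import Data.Product using (Σ; ∃; _×_)
open import Data.Sum using (_⊎_)
open import Relation.Nullary using (¬_)
open import Relation.Binary.PropositionalEquality using (_≡_)

module _ {c ℓ : Level} (G : Group c ℓ) where
  open Group G

  data Gen {s : Level} (S : Carrier → Set s) : Carrier → Set (c ⊔ ℓ ⊔ s) where
    gen  : ∀ {x} → S x → Gen S x
    unit : Gen S ε
    mul  : ∀ {x y} → Gen S x → Gen S y → Gen S (x ∙ y)
    inv  : ∀ {x} → Gen S x → Gen S (x ⁻¹)
    resp : ∀ {x y} → x ≈ y → Gen S x → Gen S y

  InCyc : Carrier → Carrier → Set (c ⊔ ℓ)
  InCyc x g = Gen (λ z → z ≈ g) x

  Gen2 : Carrier → Carrier → Carrier → Set (c ⊔ ℓ)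
  Gen2 a b = Gen (λ z → (z ≈ a) ⊎ (z ≈ b))

  IsCyclic : (Carrier → Set (c ⊔ ℓ)) → Set (c ⊔ ℓ)
  IsCyclic H = ∃ λ g → H g × (∀ z → H z → InCyc z g)

  -- Adjacency in the difference graph D(G) = EPow(G) - Pow(G).
  DAdj : Carrier → Carrier → Set (c ⊔ ℓ)
  DAdj x y = IsCyclic (Gen2 x y) × ¬ InCyc x y × ¬ InCyc y x

  -- Vertices of D(G): elements not isolated in EPow(G) - Pow(G).
  DVertex : Carrier → Set (c ⊔ ℓ)
  DVertex x = ∃ λ y → DAdj x y

  data DWalk : ℕ → Carrier → Carrier → Set (c ⊔ ℓ) where
    nil  : ∀ {x y} → x ≈ y → DWalk zero x y
    cons : ∀ {n x y z} → DAdj x y → DWalk n y z → DWalk (suc n) x z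

  HasOrder : ℕ → Set (c ⊔ ℓ)
  HasOrder n = Σ (Fin n → Carrier) λ f →
    (∀ i j → f i ≈ f j → i ≡ j) × (∀ x → ∃ λ i → f i ≈ x)

  UpperCentral : ℕ → Carrier → Set (c ⊔ ℓ)
  UpperCentral zero    x = Lift c (x ≈ ε)
  UpperCentral (suc i) x = ∀ g → UpperCentral i (((x ⁻¹ ∙ g ⁻¹) ∙ x) ∙ g)

  IsNilpotent : Set (c ⊔ ℓ)
  IsNilpotent = ∃ λ k → ∀ x → UpperCentral k x

module Submission where

-- Every vertex x of D(G) has a neighbour of prime-power order. If ⟨x , y⟩ = ⟨z⟩ with y ∉ ⟨x⟩, then z ∉ ⟨x⟩,
-- so some primary component w of z lies outside ⟨x⟩; either x ∉ ⟨w⟩ and w is such a neighbour, or x has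
-- prime-power order and is adjacent to any element of another prime order (which exists by Cauchy, as |G|
-- is not a prime power). Adjacency of elements of coprime orders comes from nilpotency: such elements
-- commute, so they generate a cyclic group in which neither is a power of the other. Two such neighbours
-- of distinct primes are adjacent, and two of the same prime p are both adjacent to an element of another
-- prime order, so any two vertices are joined by a walk of length at most 4.

open import Defs
open import Algebra.Bundles using (Group)
open import Data.Bool using (Bool; true; false; not; if_then_else_; _∧_)
open import Data.Empty using (⊥-elim)
open import Data.Fin as Fin using (Fin; zero; suc; toℕ; remQuot; combine)
open import Data.Fin.Properties using (suc-injective; <-cmp; toℕ<n; combine-remQuot; remQuot-combine; toℕ-fromℕ<; pigeonhole; any?; all?; cantor-schröder-bernstein)
open import Data.List using (List; []; _∷_; _++_; [_]; foldr; length)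
open import Data.List.Relation.Unary.All using (All; []; _∷_)
open import Data.Nat as ℕ using (ℕ; zero; suc; _+_; _*_; _≤_; _<_; _^_; z≤n; s≤s; NonZero; NonTrivial; ≢-nonZero; nonTrivial⇒n>1)
open import Data.Nat.Coprimality as Coprime using (Coprime; prime⇒coprime; coprime-divisor; 1-coprimeTo; coprime⇒gcd≡1)
open import Data.Nat.DivMod using (_%_; _/_; m≡m%n+[m/n]*n; m%n<n)
open import Data.Nat.Divisibility using (_∣_; divides; _∣?_; ∣⇒≤; ∣-refl; ∣-trans; m∣m*n; ∣n⇒∣m*n; quotient; quotient-<; quotient≢0; m∣n⇒n≡m*quotient)
open import Data.Nat.GCD using (gcd; gcd-GCD; gcd[m,n]∣m; gcd[m,n]∣n; module Bézout)
open import Data.Nat.Induction using (<-rec)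
open import Data.Nat.ListAction using (product)
open import Data.Nat.Primality using (Prime; prime[2]; euclidsLemma; prime⇒irreducible; prime⇒nonTrivial; ¬prime[0]; ¬prime[1])
open import Data.Nat.Primality.Factorisation using (factorise)
open import Data.Nat.Properties using (m<n⇒0<n; ≤-refl; ^-identityʳ; ≤-trans; m<m*n; *-identityˡ; *-assoc; *-comm; *-suc; +-suc; ^-zeroˡ; ≤∧≢⇒<; ≤-<-trans; m≤n+m; n<1+n; m≤n⇒∃[o]m+o≡n)
open import Data.Product using (∃; ∃₂; _×_; _,_; proj₁; proj₂; uncurry)
open import Data.Sum using (_⊎_; inj₁; inj₂; swap)
open import Data.Vec using (Vec; lookup; []; _∷_)
open import Function using (id; _∘_)
open import Level as Level using (Level; _⊔_; lift; lower)
open import Relation.Binary.Definitions using (tri<; tri≈; tri>)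
open import Relation.Binary.PropositionalEquality as ≡ using (_≡_; _≢_)
open import Relation.Nullary using (¬_; Dec; yes; no; does)
open import Relation.Nullary.Decidable using (_×-dec_; _→-dec_; ¬?)

-- Identities in groups are decided by free reduction of words in the generators.
module GroupSolver where

  infixl 7 _·_
  infix 8 _⁻

  data Term (n : ℕ) : Set where
    var : Fin n → Term n
    one : Term n
    _·_ : Term n → Term n → Term n
    _⁻  : Term n → Term n

  x₀ : ∀ {n} → Term (1 + n)
  x₀ = var zero

  x₁ : ∀ {n} → Term (2 + n)
  x₁ = var (suc zero)

  x₂ : ∀ {n} → Term (3 + n)
  x₂ = var (suc (suc zero))

  x₃ : ∀ {n} → Term (4 + n)
  x₃ = var (suc (suc (suc zero)))

  -- A letter (i , b) stands for the i-th generator, inverted iff b.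
  Letter : ℕ → Set
  Letter n = Fin n × Bool

  invertLetter : ∀ {n} → Letter n → Letter n
  invertLetter (i , b) = i , not b

  invertWord : ∀ {n} → List (Letter n) → List (Letter n)
  invertWord []      = []
  invertWord (l ∷ w) = invertWord w ++ [ invertLetter l ]

  word : ∀ {n} → Term n → List (Letter n)
  word (var i) = [ i , false ]
  word one     = []
  word (a · b) = word a ++ word b
  word (a ⁻)   = invertWord (word a)

  cancels : ∀ {n} → Letter n → Letter n → Bool
  cancels (i , b) (j , b′) = does (i Fin.≟ j) ∧ (if b then not b′ else b′)

  push : ∀ {n} → Letter n → List (Letter n) → List (Letter n)
  push l []       = [ l ]
  push l (l′ ∷ w) = if cancels l l′ then w else l ∷ l′ ∷ w

  reduce : ∀ {n} → List (Letter n) → List (Letter n)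
  reduce = foldr push []

  module Semantics {c ℓ} (G : Group c ℓ) where
    open Group G
    open import Algebra.Properties.Group G using (⁻¹-involutive; ε⁻¹≈ε; ⁻¹-anti-homo-∙)
    open import Relation.Binary.Reasoning.Setoid setoid

    ⟦_⟧ : ∀ {n} → Term n → Vec Carrier n → Carrier
    ⟦ var i ⟧ ρ = lookup ρ i
    ⟦ one ⟧   ρ = ε
    ⟦ a · b ⟧ ρ = ⟦ a ⟧ ρ ∙ ⟦ b ⟧ ρ
    ⟦ a ⁻ ⟧   ρ = ⟦ a ⟧ ρ ⁻¹

    module _ {n} (ρ : Vec Carrier n) where

      ⟦_⟧ˡ : Letter n → Carrier
      ⟦ i , false ⟧ˡ = lookup ρ i
      ⟦ i , true ⟧ˡ  = lookup ρ i ⁻¹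

      ⟦_⟧ʷ : List (Letter n) → Carrier
      ⟦ [] ⟧ʷ    = ε
      ⟦ l ∷ w ⟧ʷ = ⟦ l ⟧ˡ ∙ ⟦ w ⟧ʷ

      ⟦++⟧ : ∀ u v → ⟦ u ++ v ⟧ʷ ≈ ⟦ u ⟧ʷ ∙ ⟦ v ⟧ʷ
      ⟦++⟧ []      v = sym (identityˡ _)
      ⟦++⟧ (l ∷ u) v = trans (∙-congˡ (⟦++⟧ u v)) (sym (assoc _ _ _))

      ⟦invertLetter⟧ : ∀ l → ⟦ invertLetter l ⟧ˡ ≈ ⟦ l ⟧ˡ ⁻¹
      ⟦invertLetter⟧ (i , false) = refl
      ⟦invertLetter⟧ (i , true)  = sym (⁻¹-involutive _)

      ⟦invertWord⟧ : ∀ w → ⟦ invertWord w ⟧ʷ ≈ ⟦ w ⟧ʷ ⁻¹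
      ⟦invertWord⟧ []      = sym ε⁻¹≈ε
      ⟦invertWord⟧ (l ∷ w) = begin
        ⟦ invertWord w ++ [ invertLetter l ] ⟧ʷ        ≈⟨ ⟦++⟧ (invertWord w) _ ⟩
        ⟦ invertWord w ⟧ʷ ∙ (⟦ invertLetter l ⟧ˡ ∙ ε)  ≈⟨ ∙-cong (⟦invertWord⟧ w) (trans (identityʳ _) (⟦invertLetter⟧ l)) ⟩
        ⟦ w ⟧ʷ ⁻¹ ∙ ⟦ l ⟧ˡ ⁻¹                          ≈⟨ ⁻¹-anti-homo-∙ _ _ ⟨
        (⟦ l ⟧ˡ ∙ ⟦ w ⟧ʷ) ⁻¹                           ∎

      ⟦word⟧ : ∀ a → ⟦ word a ⟧ʷ ≈ ⟦ a ⟧ ρ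
      ⟦word⟧ (var i) = identityʳ _
      ⟦word⟧ one     = refl
      ⟦word⟧ (a · b) = trans (⟦++⟧ (word a) (word b)) (∙-cong (⟦word⟧ a) (⟦word⟧ b))
      ⟦word⟧ (a ⁻)   = trans (⟦invertWord⟧ (word a)) (⁻¹-cong (⟦word⟧ a))

      cancels-sound : ∀ l l′ → cancels l l′ ≡ true → ∀ x → ⟦ l ⟧ˡ ∙ (⟦ l′ ⟧ˡ ∙ x) ≈ x
      cancels-sound (i , b) (j , b′) eq x with i Fin.≟ j
      cancels-sound (i , false) (.i , true)  eq x | yes ≡.refl =
        trans (sym (assoc _ _ _)) (trans (∙-congʳ (inverseʳ _)) (identityˡ x))
      cancels-sound (i , true)  (.i , false) eq x | yes ≡.refl =
        trans (sym (assoc _ _ _)) (trans (∙-congʳ (inverseˡ _)) (identityˡ x))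

      ⟦push⟧ : ∀ l w → ⟦ push l w ⟧ʷ ≈ ⟦ l ⟧ˡ ∙ ⟦ w ⟧ʷ
      ⟦push⟧ l []       = refl
      ⟦push⟧ l (l′ ∷ w) with cancels l l′ in eq
      ... | true  = sym (cancels-sound l l′ eq ⟦ w ⟧ʷ)
      ... | false = refl

      ⟦reduce⟧ : ∀ w → ⟦ reduce w ⟧ʷ ≈ ⟦ w ⟧ʷ
      ⟦reduce⟧ []      = refl
      ⟦reduce⟧ (l ∷ w) = trans (⟦push⟧ l (reduce w)) (∙-congˡ (⟦reduce⟧ w))

    solve : ∀ {n} (a b : Term n) → reduce (word a) ≡ reduce (word b) →
            (ρ : Vec Carrier n) → ⟦ a ⟧ ρ ≈ ⟦ b ⟧ ρ
    solve a b eq ρ = begin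
      ⟦ a ⟧ ρ                       ≈⟨ ⟦word⟧ ρ a ⟨
      ⟦_⟧ʷ ρ (word a)               ≈⟨ ⟦reduce⟧ ρ (word a) ⟨
      ⟦_⟧ʷ ρ (reduce (word a))      ≡⟨ ≡.cong (⟦_⟧ʷ ρ) eq ⟩
      ⟦_⟧ʷ ρ (reduce (word b))      ≈⟨ ⟦reduce⟧ ρ (word b) ⟩
      ⟦_⟧ʷ ρ (word b)               ≈⟨ ⟦word⟧ ρ b ⟩
      ⟦ b ⟧ ρ                       ∎

prime∤⇒coprime : ∀ {p n} → Prime p → ¬ p ∣ n → Coprime p n
prime∤⇒coprime p-prime p∤n (d∣p , d∣n) with prime⇒irreducible p-prime d∣p
... | inj₁ d≡1 = d≡1
... | inj₂ ≡.refl = ⊥-elim (p∤n d∣n)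

distinct-primes⇒coprime : ∀ {p q} → Prime p → Prime q → p ≢ q → Coprime p q
distinct-primes⇒coprime p-prime q-prime p≢q = prime∤⇒coprime p-prime p∤q
  where
  p∤q : ¬ _ ∣ _
  p∤q p∣q with prime⇒irreducible q-prime p∣q
  ... | inj₁ ≡.refl = ¬prime[1] p-prime
  ... | inj₂ p≡q = p≢q p≡q

coprime-*ˡ : ∀ {m k n} → Coprime m n → Coprime k n → Coprime (m * k) n
coprime-*ˡ m⊥n k⊥n (d∣mk , d∣n) =
  k⊥n (coprime-divisor (λ (i∣d , i∣m) → m⊥n (i∣m , ∣-trans i∣d d∣n)) d∣mk , d∣n)

coprime-^ˡ : ∀ {m n} → Coprime m n → ∀ e → Coprime (m ^ e) n
coprime-^ˡ {n = n} m⊥n zero    = 1-coprimeTo n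
coprime-^ˡ         m⊥n (suc e) = coprime-*ˡ m⊥n (coprime-^ˡ m⊥n e)

prime-powers-coprime : ∀ {s t} → Prime s → Prime t → s ≢ t → ∀ e f → Coprime (s ^ e) (t ^ f)
prime-powers-coprime s-prime t-prime s≢t e f =
  coprime-^ˡ (Coprime.sym (coprime-^ˡ (Coprime.sym (distinct-primes⇒coprime s-prime t-prime s≢t)) f)) e

-- A prime factorisation not exhausted by s contains another prime.
∃-prime∣≢ : ∀ n s → .{{NonZero n}} → ¬ (∃ λ k → n ≡ s ^ k) → ∃ λ t → Prime t × t ∣ n × t ≢ s
∃-prime∣≢ n s n≢s^k with factorise n
... | record { factors = ps ; isFactorisation = n≡∏ps ; factorsPrime = ps-prime } with other ps ps-prime
  where
  other : ∀ ps → All Prime ps → (∃ λ t → Prime t × t ∣ product ps × t ≢ s) ⊎ product ps ≡ s ^ length ps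
  other []       []       = inj₂ ≡.refl
  other (t ∷ ps) (t-prime ∷ ps-prime) with t ℕ.≟ s | other ps ps-prime
  ... | no t≢s   | _ = inj₁ (t , t-prime , m∣m*n (product ps) , t≢s)
  ... | yes _    | inj₁ (u , u-prime , u∣ , u≢s) = inj₁ (u , u-prime , ∣n⇒∣m*n t u∣ , u≢s)
  ... | yes ≡.refl | inj₂ ∏≡s^k = inj₂ (≡.cong (t *_) ∏≡s^k)
... | inj₁ (t , t-prime , t∣∏ , t≢s) = t , t-prime , ≡.subst (t ∣_) (≡.sym n≡∏ps) t∣∏ , t≢s
... | inj₂ ∏≡s^k = ⊥-elim (n≢s^k (length ps , ≡.trans n≡∏ps ∏≡s^k))

∃-prime∣ : ∀ n → .{{NonTrivial n}} → ∃ λ p → Prime p × p ∣ n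
∃-prime∣ n@(suc (suc _)) with ∃-prime∣≢ n 1 n≢1^k
  where
  n≢1^k : ¬ (∃ λ k → n ≡ 1 ^ k)
  n≢1^k (k , n≡1^k) with ≡.trans n≡1^k (^-zeroˡ k)
  ... | ()
... | p , p-prime , p∣n , _ = p , p-prime , p∣n

factor-out : ∀ {s} → Prime s → ∀ M → .{{NonZero M}} → ∃₂ λ a M′ → M ≡ s ^ a * M′ × ¬ s ∣ M′
factor-out {s} s-prime M = <-rec P step M
  where
  instance _ = prime⇒nonTrivial s-prime
  P : ℕ → Set
  P M = .{{NonZero M}} → ∃₂ λ a M′ → M ≡ s ^ a * M′ × ¬ s ∣ M′
  step : ∀ M → (∀ {K} → K < M → P K) → P M
  step M rec with s ∣? M
  ... | no s∤M = 0 , M , ≡.sym (*-identityˡ M) , s∤M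
  ... | yes s∣M with rec (quotient-< s∣M) {{quotient≢0 s∣M}}
  ...   | a , M′ , q≡sᵃM′ , s∤M′ = suc a , M′ , M≡s^[1+a]M′ , s∤M′
    where
    M≡s^[1+a]M′ : M ≡ s * s ^ a * M′
    M≡s^[1+a]M′ = ≡.trans (m∣n⇒n≡m*quotient s∣M) (≡.trans (≡.cong (s *_) q≡sᵃM′) (≡.sym (*-assoc s (s ^ a) M′)))

record Enumeration {p n} (P : Fin n → Set p) : Set p where
  field
    size          : ℕ
    at            : Fin size → Fin n
    at-injective  : ∀ {a b} → at a ≡ at b → a ≡ b
    at-satisfies  : ∀ a → P (at a)
    at-surjective : ∀ {i} → P i → ∃ λ a → at a ≡ i

enumerate : ∀ {p n} {P : Fin n → Set p} → (∀ i → Dec (P i)) → Enumeration P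
enumerate {n = zero} P? = record
  { size = 0 ; at = λ () ; at-injective = λ { {()} } ; at-satisfies = λ () ; at-surjective = λ { {()} } }
enumerate {n = suc n} {P} P? with enumerate (P? ∘ suc) | P? zero
... | E | yes P0 = record
  { size = suc size ; at = at′ ; at-injective = at′-injective ; at-satisfies = at′-satisfies ; at-surjective = at′-surjective }
  where
  open Enumeration E
  at′ : Fin (suc size) → Fin (suc n)
  at′ zero    = zero
  at′ (suc a) = suc (at a)
  at′-injective : ∀ {a b} → at′ a ≡ at′ b → a ≡ b
  at′-injective {zero}  {zero}  _    = ≡.refl
  at′-injective {suc a} {suc b} same = ≡.cong suc (at-injective (suc-injective same))
  at′-satisfies : ∀ a → P (at′ a)
  at′-satisfies zero    = P0
  at′-satisfies (suc a) = at-satisfies a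
  at′-surjective : ∀ {i} → P i → ∃ λ a → at′ a ≡ i
  at′-surjective {zero}  _  = zero , ≡.refl
  at′-surjective {suc i} Pi = let a , at-a≡i = at-surjective Pi in suc a , ≡.cong suc at-a≡i
... | E | no ¬P0 = record
  { size = size ; at = suc ∘ at ; at-injective = at-injective ∘ suc-injective
  ; at-satisfies = at-satisfies ; at-surjective = at′-surjective }
  where
  open Enumeration E
  at′-surjective : ∀ {i} → P i → ∃ λ a → suc (at a) ≡ i
  at′-surjective {zero}  P0 = ⊥-elim (¬P0 P0)
  at′-surjective {suc i} Pi = let a , at-a≡i = at-surjective Pi in a , ≡.cong suc at-a≡i

least : ∀ {p n} {P : Fin n → Set p} → (∀ i → Dec (P i)) → ∀ {i} → P i →
        ∃ λ j → P j × (∀ k → k Fin.< j → ¬ P k)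
least {n = suc n} P? {i} Pi with P? zero
... | yes P0 = zero , P0 , λ _ ()
least {n = suc n} P? {zero}  Pi | no ¬P0 = ⊥-elim (¬P0 Pi)
least {n = suc n} P? {suc i} Pi | no ¬P0 with least (P? ∘ suc) Pi
... | j , Pj , below-j = suc j , Pj , λ where
  zero    _         → ¬P0
  (suc k) (s≤s k<j) → below-j k k<j

module Subgroups {c ℓ} (G : Group c ℓ) where
  open Group G
  open import Algebra.Properties.Group G using (x≈z//y; ε⁻¹≈ε; inverseʳ-unique; identityʳ-unique)
  open GroupSolver
  open Semantics G
  open import Algebra.Properties.Monoid.Mult monoid public
    using (×-congʳ; ×-homo-1; ×-homo-+; ×-assocˡ) renaming (_×_ to _×ᴹ_)
  open import Relation.Binary.Reasoning.Setoid setoid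

  pow : Carrier → ℕ → Carrier
  pow x k = k ×ᴹ x

  pow-ε : ∀ k → pow ε k ≈ ε
  pow-ε zero    = refl
  pow-ε (suc k) = trans (identityˡ _) (pow-ε k)

  pow-comm : ∀ {x y} → x ∙ y ≈ y ∙ x → ∀ k → pow x k ∙ y ≈ y ∙ pow x k
  pow-comm xy≈yx zero    = trans (identityˡ _) (sym (identityʳ _))
  pow-comm {x} {y} xy≈yx (suc k) = begin
    (x ∙ pow x k) ∙ y  ≈⟨ assoc _ _ _ ⟩
    x ∙ (pow x k ∙ y)  ≈⟨ ∙-congˡ (pow-comm xy≈yx k) ⟩
    x ∙ (y ∙ pow x k)  ≈⟨ assoc _ _ _ ⟨
    (x ∙ y) ∙ pow x k  ≈⟨ ∙-congʳ xy≈yx ⟩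
    (y ∙ x) ∙ pow x k  ≈⟨ assoc _ _ _ ⟩
    y ∙ (x ∙ pow x k)  ∎

  pow-distrib-∙ : ∀ {x y} → x ∙ y ≈ y ∙ x → ∀ k → pow (x ∙ y) k ≈ pow x k ∙ pow y k
  pow-distrib-∙ xy≈yx zero = sym (identityˡ ε)
  pow-distrib-∙ {x} {y} xy≈yx (suc k) = begin
    (x ∙ y) ∙ pow (x ∙ y) k          ≈⟨ ∙-congˡ (pow-distrib-∙ xy≈yx k) ⟩
    (x ∙ y) ∙ (pow x k ∙ pow y k)    ≈⟨ assoc _ _ _ ⟩
    x ∙ (y ∙ (pow x k ∙ pow y k))    ≈⟨ ∙-congˡ (assoc _ _ _) ⟨
    x ∙ ((y ∙ pow x k) ∙ pow y k)    ≈⟨ ∙-congˡ (∙-congʳ (pow-comm xy≈yx k)) ⟨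
    x ∙ ((pow x k ∙ y) ∙ pow y k)    ≈⟨ ∙-congˡ (assoc _ _ _) ⟩
    x ∙ (pow x k ∙ (y ∙ pow y k))    ≈⟨ assoc _ _ _ ⟨
    (x ∙ pow x k) ∙ (y ∙ pow y k)    ∎

  pow-*≈ε : ∀ {x N} → pow x N ≈ ε → ∀ k → pow x (k * N) ≈ ε
  pow-*≈ε {x} {N} xᴺ≈ε k = trans (sym (×-assocˡ x k N)) (trans (×-congʳ k xᴺ≈ε) (pow-ε k))

  pow-inverse : ∀ {g N} → pow g (suc N) ≈ ε → ∀ k → pow g k ⁻¹ ≈ pow g (k * N)
  pow-inverse {g} {N} g^[1+N]≈ε k = sym (inverseʳ-unique (pow g k) (pow g (k * N)) (begin
    pow g k ∙ pow g (k * N)  ≈⟨ ×-homo-+ g k (k * N) ⟨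
    pow g (k + k * N)        ≡⟨ ≡.cong (pow g) (≡.sym (*-suc k N)) ⟩
    pow g (k * suc N)        ≈⟨ pow-*≈ε g^[1+N]≈ε k ⟩
    ε                        ∎))

  IsPrimary : Carrier → Set ℓ
  IsPrimary w = ∃₂ λ p e → Prime p × pow w (p ^ e) ≈ ε

  -- For a prime p, an element of order exactly p.
  HasElementOfOrder : ℕ → Set (c ⊔ ℓ)
  HasElementOfOrder p = ∃ λ u → ¬ u ≈ ε × pow u p ≈ ε

  record IsSubgroup {h} (H : Carrier → Set h) : Set (c ⊔ ℓ ⊔ h) where
    field
      ≈-closed  : ∀ {x y} → x ≈ y → H x → H y
      ε-closed  : H ε
      ∙-closed  : ∀ {x y} → H x → H y → H (x ∙ y)
      ⁻¹-closed : ∀ {x} → H x → H (x ⁻¹)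

    pow-closed : ∀ {x} k → H x → H (pow x k)
    pow-closed zero    _  = ε-closed
    pow-closed (suc k) hx = ∙-closed hx (pow-closed k hx)

    bézout-closed : ∀ {u d A B} → Bézout.Identity d A B → H (pow u A) → H (pow u B) → H (pow u d)
    bézout-closed {u} {d} {A} {B} (Bézout.+- x y d+yB≡xA) huᴬ huᴮ =
      ≈-closed (sym (x≈z//y (pow u d) (pow u (y * B)) (pow u (x * A)) (begin
        pow u d ∙ pow u (y * B)  ≈⟨ ×-homo-+ u d (y * B) ⟨
        pow u (d + y * B)        ≡⟨ ≡.cong (pow u) d+yB≡xA ⟩
        pow u (x * A)            ∎)))
        (∙-closed (multiple huᴬ x) (⁻¹-closed (multiple huᴮ y)))
      where
      multiple : ∀ {C} → H (pow u C) → ∀ k → H (pow u (k * C))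
      multiple {C} huᶜ k = ≈-closed (×-assocˡ u k C) (pow-closed k huᶜ)
    bézout-closed (Bézout.-+ x y d+xA≡yB) huᴬ huᴮ = bézout-closed (Bézout.+- y x d+xA≡yB) huᴮ huᴬ

    gcd-closed : ∀ {u} A B → H (pow u A) → H (pow u B) → H (pow u (gcd A B))
    gcd-closed A B = bézout-closed (Bézout.identity (gcd-GCD A B))

    coprime-closed : ∀ {u A B} → Coprime A B → H (pow u A) → H (pow u B) → H u
    coprime-closed {u} {A} {B} A⊥B huᴬ huᴮ =
      ≈-closed (×-homo-1 u) (≡.subst (λ d → H (pow u d)) (coprime⇒gcd≡1 A⊥B) (gcd-closed A B huᴬ huᴮ))

  ≈ε-isSubgroup : IsSubgroup (_≈ ε)
  ≈ε-isSubgroup = record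
    { ≈-closed  = λ x≈y x≈ε → trans (sym x≈y) x≈ε
    ; ε-closed  = refl
    ; ∙-closed  = λ x≈ε y≈ε → trans (∙-cong x≈ε y≈ε) (identityˡ ε)
    ; ⁻¹-closed = λ x≈ε → trans (⁻¹-cong x≈ε) ε⁻¹≈ε
    }

  Gen-isSubgroup : ∀ {s} {S : Carrier → Set s} → IsSubgroup (Gen G S)
  Gen-isSubgroup = record { ≈-closed = resp ; ε-closed = unit ; ∙-closed = mul ; ⁻¹-closed = inv }

  module Trivial = IsSubgroup ≈ε-isSubgroup
  module Generated {s} {S : Carrier → Set s} = IsSubgroup (Gen-isSubgroup {S = S})

  record IsNormalSubgroup {h} (H : Carrier → Set h) : Set (c ⊔ ℓ ⊔ h) where
    field
      isSubgroup  : IsSubgroup H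
      conj-closed : ∀ {x} → H x → ∀ g → H (g ⁻¹ ∙ x ∙ g)
    open IsSubgroup isSubgroup public

  pow-% : ∀ {g N} → pow g (suc N) ≈ ε → ∀ k → pow g k ≈ pow g (k % suc N)
  pow-% {g} {N} gᴺ≈ε k = begin
    pow g k                                       ≡⟨ ≡.cong (pow g) (m≡m%n+[m/n]*n k (suc N)) ⟩
    pow g (k % suc N + k / suc N * suc N)         ≈⟨ ×-homo-+ g (k % suc N) _ ⟩
    pow g (k % suc N) ∙ pow g (k / suc N * suc N) ≈⟨ ∙-congˡ (pow-*≈ε gᴺ≈ε (k / suc N)) ⟩
    pow g (k % suc N) ∙ ε                         ≈⟨ identityʳ _ ⟩
    pow g (k % suc N)                             ∎

  pow-residue : ∀ {g N} → pow g (suc N) ≈ ε → ∀ k → ∃ λ (r : Fin (suc N)) → pow g k ≈ pow g (toℕ r)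
  pow-residue {g} {N} gᴺ≈ε k =
    Fin.fromℕ< (m%n<n k (suc N)) ,
    trans (pow-% gᴺ≈ε k) (reflexive (≡.cong (pow g) (≡.sym (toℕ-fromℕ< (m%n<n k (suc N))))))

  -- If conjugation by y multiplies x by a central c, then conjugation by y^k multiplies it by c^k.
  central-conjugation-pow≈ε : ∀ {x y c b} → (∀ g → c ∙ g ≈ g ∙ c) → y ⁻¹ ∙ x ∙ y ≈ x ∙ c →
                               pow y b ≈ ε → pow c b ≈ ε
  central-conjugation-pow≈ε {x} {y} {c} {b} central conj yᵇ≈ε =
    identityʳ-unique x (pow c b) (sym (begin
      x                          ≈⟨ solve x₀ (one ⁻ · x₀ · one) ≡.refl (x ∷ []) ⟩
      ε ⁻¹ ∙ x ∙ ε               ≈⟨ ∙-cong (∙-congʳ (⁻¹-cong yᵇ≈ε)) yᵇ≈ε ⟨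
      pow y b ⁻¹ ∙ x ∙ pow y b   ≈⟨ conj-pow b ⟩
      x ∙ pow c b                ∎))
    where
    conj-pow : ∀ k → pow y k ⁻¹ ∙ x ∙ pow y k ≈ x ∙ pow c k
    conj-pow zero    = solve (one ⁻ · x₀ · one) (x₀ · one) ≡.refl (x ∷ [])
    conj-pow (suc k) = begin
      (y ∙ Y) ⁻¹ ∙ x ∙ (y ∙ Y)     ≈⟨ solve ((x₀ · x₂) ⁻ · x₁ · (x₀ · x₂)) (x₂ ⁻ · (x₀ ⁻ · x₁ · x₀) · x₂) ≡.refl ρ ⟩
      Y ⁻¹ ∙ (y ⁻¹ ∙ x ∙ y) ∙ Y    ≈⟨ ∙-congʳ (∙-congˡ conj) ⟩
      Y ⁻¹ ∙ (x ∙ c) ∙ Y           ≈⟨ solve (x₂ ⁻ · (x₁ · x₃) · x₂) ((x₂ ⁻ · x₁) · (x₃ · x₂)) ≡.refl ρ ⟩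
      (Y ⁻¹ ∙ x) ∙ (c ∙ Y)         ≈⟨ ∙-congˡ (central Y) ⟩
      (Y ⁻¹ ∙ x) ∙ (Y ∙ c)         ≈⟨ solve ((x₂ ⁻ · x₁) · (x₂ · x₃)) (x₂ ⁻ · x₁ · x₂ · x₃) ≡.refl ρ ⟩
      Y ⁻¹ ∙ x ∙ Y ∙ c             ≈⟨ ∙-congʳ (conj-pow k) ⟩
      x ∙ pow c k ∙ c              ≈⟨ assoc _ _ _ ⟩
      x ∙ (pow c k ∙ c)            ≈⟨ ∙-congˡ (pow-comm refl k) ⟩
      x ∙ (c ∙ pow c k)            ∎
      where
      Y : Carrier
      Y = pow y k
      ρ : Vec Carrier 4
      ρ = y ∷ x ∷ Y ∷ c ∷ []

module CyclicSubgroups {c ℓ} (G : Group c ℓ) where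
  open Group G
  open Subgroups G
  open import Relation.Binary.Reasoning.Setoid setoid

  Gen-map : ∀ {s t} {S : Carrier → Set s} {T : Carrier → Set t} →
            (∀ {x} → S x → Gen G T x) → ∀ {y} → Gen G S y → Gen G T y
  Gen-map f (gen s)      = f s
  Gen-map f unit         = unit
  Gen-map f (mul hx hy)  = mul (Gen-map f hx) (Gen-map f hy)
  Gen-map f (inv hx)     = inv (Gen-map f hx)
  Gen-map f (resp e hx)  = resp e (Gen-map f hx)

  ≈ε⇒InCyc : ∀ {x g} → x ≈ ε → InCyc G x g
  ≈ε⇒InCyc x≈ε = resp (sym x≈ε) unit

  pow-InCyc : ∀ g k → InCyc G (pow g k) g
  pow-InCyc g k = Generated.pow-closed k (gen refl)

  InCyc-trans : ∀ {x y z} → InCyc G x y → InCyc G y z → InCyc G x z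
  InCyc-trans x∈⟨y⟩ y∈⟨z⟩ = Gen-map (λ w≈y → resp (sym w≈y) y∈⟨z⟩) x∈⟨y⟩

  InCyc⇒pow : ∀ {g N x} → pow g (suc N) ≈ ε → InCyc G x g → ∃ λ k → x ≈ pow g k
  InCyc⇒pow {g} e (gen x≈g) = 1 , trans x≈g (sym (×-homo-1 g))
  InCyc⇒pow e unit          = 0 , refl
  InCyc⇒pow {g} {N} e (mul hx hy) with InCyc⇒pow {N = N} e hx | InCyc⇒pow {N = N} e hy
  ... | i , x≈gⁱ | j , y≈gʲ = i + j , trans (∙-cong x≈gⁱ y≈gʲ) (sym (×-homo-+ g i j))
  InCyc⇒pow {N = N} e (inv hx) with InCyc⇒pow {N = N} e hx
  ... | i , x≈gⁱ = i * N , trans (⁻¹-cong x≈gⁱ) (pow-inverse e i)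
  InCyc⇒pow {N = N} e (resp x≈y hx) with InCyc⇒pow {N = N} e hx
  ... | i , x≈gⁱ = i , trans (sym x≈y) x≈gⁱ

  InCyc⇒pow≈ε : ∀ {g x} N → pow g N ≈ ε → InCyc G x g → pow x N ≈ ε
  InCyc⇒pow≈ε zero    _     _  = refl
  InCyc⇒pow≈ε {g} {x} (suc N) gᴺ≈ε x∈⟨g⟩ with InCyc⇒pow {N = N} gᴺ≈ε x∈⟨g⟩
  ... | k , x≈gᵏ = begin
    pow x (suc N)          ≈⟨ ×-congʳ (suc N) x≈gᵏ ⟩
    pow (pow g k) (suc N)  ≈⟨ ×-assocˡ g (suc N) k ⟩
    pow g (suc N * k)      ≡⟨ ≡.cong (pow g) (*-comm (suc N) k) ⟩
    pow g (k * suc N)      ≈⟨ pow-*≈ε gᴺ≈ε k ⟩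
    ε                      ∎

  ∣⇒InCyc : ∀ z {d m} → d ∣ m → InCyc G (pow z m) (pow z d)
  ∣⇒InCyc z {d} (divides q ≡.refl) = resp (×-assocˡ z q d) (pow-InCyc (pow z d) q)

  powers-generate-cyclic : ∀ {a b z k l} → a ≈ pow z k → b ≈ pow z l → IsCyclic G (Gen2 G a b)
  powers-generate-cyclic {a} {b} {z} {k} {l} a≈zᵏ b≈zˡ =
    pow z (gcd k l) ,
    Generated.gcd-closed k l (resp a≈zᵏ (gen (inj₁ refl))) (resp b≈zˡ (gen (inj₂ refl))) ,
    λ _ → Gen-map generator∈
    where
    generator∈ : ∀ {x} → (x ≈ a) ⊎ (x ≈ b) → InCyc G x (pow z (gcd k l))
    generator∈ (inj₁ x≈a) = resp (sym (trans x≈a a≈zᵏ)) (∣⇒InCyc z (gcd[m,n]∣m k l))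
    generator∈ (inj₂ x≈b) = resp (sym (trans x≈b b≈zˡ)) (∣⇒InCyc z (gcd[m,n]∣n k l))

  DAdj-sym : ∀ {a b} → DAdj G a b → DAdj G b a
  DAdj-sym ((g , g∈ , ⊆⟨g⟩) , a∉⟨b⟩ , b∉⟨a⟩) =
    (g , swap-generators g∈ , λ z z∈ → ⊆⟨g⟩ z (swap-generators z∈)) , b∉⟨a⟩ , a∉⟨b⟩
    where
    swap-generators : ∀ {a b z} → Gen2 G a b z → Gen2 G b a z
    swap-generators = Gen-map (λ e → gen (swap e))

  -- The cyclic group in question is ⟨a ∙ b⟩.
  coprime-commuting⇒DAdj : ∀ {a b M N} → ¬ a ≈ ε → ¬ b ≈ ε → a ∙ b ≈ b ∙ a →
                            pow a M ≈ ε → pow b N ≈ ε → Coprime M N → DAdj G a b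
  coprime-commuting⇒DAdj {a} {b} {M} {N} a≉ε b≉ε ab≈ba aᴹ≈ε bᴺ≈ε M⊥N =
    (a ∙ b , mul (gen (inj₁ refl)) (gen (inj₂ refl)) , λ _ → Gen-map generator∈) , a∉⟨b⟩ , b∉⟨a⟩
    where
    [ab]^ : ∀ k → pow (a ∙ b) k ≈ pow a k ∙ pow b k
    [ab]^ = pow-distrib-∙ ab≈ba
    a∈⟨ab⟩ : InCyc G a (a ∙ b)
    a∈⟨ab⟩ = Generated.coprime-closed M⊥N (≈ε⇒InCyc aᴹ≈ε)
      (resp (trans ([ab]^ N) (trans (∙-congˡ bᴺ≈ε) (identityʳ _))) (pow-InCyc (a ∙ b) N))
    b∈⟨ab⟩ : InCyc G b (a ∙ b)
    b∈⟨ab⟩ = Generated.coprime-closed M⊥N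
      (resp (trans ([ab]^ M) (trans (∙-congʳ aᴹ≈ε) (identityˡ _))) (pow-InCyc (a ∙ b) M)) (≈ε⇒InCyc bᴺ≈ε)
    generator∈ : ∀ {x} → (x ≈ a) ⊎ (x ≈ b) → InCyc G x (a ∙ b)
    generator∈ (inj₁ x≈a) = resp (sym x≈a) a∈⟨ab⟩
    generator∈ (inj₂ x≈b) = resp (sym x≈b) b∈⟨ab⟩
    a∉⟨b⟩ : ¬ InCyc G a b
    a∉⟨b⟩ a∈⟨b⟩ = a≉ε (Trivial.coprime-closed M⊥N aᴹ≈ε (InCyc⇒pow≈ε N bᴺ≈ε a∈⟨b⟩))
    b∉⟨a⟩ : ¬ InCyc G b a
    b∉⟨a⟩ b∈⟨a⟩ = b≉ε (Trivial.coprime-closed M⊥N (InCyc⇒pow≈ε M aᴹ≈ε b∈⟨a⟩) bᴺ≈ε)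

  -- Write M = s^a M′ with s ∤ M′. If g^M′ ∉ H, its order divides s^a; otherwise g^(s^a) ∉ H,
  -- and its order divides M′ < M.
  ∃-primary-outside : ∀ {h} {H : Carrier → Set h} → IsSubgroup H → (∀ x → Dec (H x)) →
                      ∀ {g} M → .{{NonZero M}} → pow g M ≈ ε → ¬ H g →
                      ∃ λ w → InCyc G w g × ¬ H w × IsPrimary w
  ∃-primary-outside {H = H} H-subgroup H? M = <-rec P step M
    where
    open IsSubgroup H-subgroup
    P : ℕ → Set _
    P M = .{{NonZero M}} → ∀ {g} → pow g M ≈ ε → ¬ H g →
          ∃ λ w → InCyc G w g × ¬ H w × IsPrimary w
    step : ∀ M → (∀ {K} → K < M → P K) → P M
    step (suc zero) rec {g} g¹≈ε g∉H = ⊥-elim (g∉H (≈-closed (trans (sym g¹≈ε) (×-homo-1 g)) ε-closed))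
    step M@(suc (suc _)) rec {g} gᴹ≈ε g∉H with ∃-prime∣ M
    ... | s , s-prime , s∣M with factor-out s-prime M
    ...   | a , M′ , M≡sᵃM′ , s∤M′ with H? (pow g M′)
    ...     | no g^M′∉H = pow g M′ , pow-InCyc g M′ , g^M′∉H , s , a , s-prime , (begin
      pow (pow g M′) (s ^ a)  ≈⟨ ×-assocˡ g (s ^ a) M′ ⟩
      pow g (s ^ a * M′)      ≡⟨ ≡.cong (pow g) M≡sᵃM′ ⟨
      pow g M                 ≈⟨ gᴹ≈ε ⟩
      ε                       ∎)
    ...     | yes g^M′∈H with rec M′<M {{M′≢0}} gˢᵃ^M′≈ε gˢᵃ∉H
      where
      M′≢0 : NonZero M′
      M′≢0 = ≢-nonZero λ { ≡.refl → s∤M′ (divides 0 ≡.refl) }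
      M′<M : M′ < M
      M′<M = ≤∧≢⇒< (∣⇒≤ (divides (s ^ a) M≡sᵃM′))
                   λ M′≡M → s∤M′ (≡.subst (s ∣_) (≡.sym M′≡M) s∣M)
      gˢᵃ^M′≈ε : pow (pow g (s ^ a)) M′ ≈ ε
      gˢᵃ^M′≈ε = begin
        pow (pow g (s ^ a)) M′  ≈⟨ ×-assocˡ g M′ (s ^ a) ⟩
        pow g (M′ * s ^ a)      ≡⟨ ≡.cong (pow g) (≡.trans (*-comm M′ (s ^ a)) (≡.sym M≡sᵃM′)) ⟩
        pow g M                 ≈⟨ gᴹ≈ε ⟩
        ε                       ∎
      gˢᵃ∉H : ¬ H (pow g (s ^ a))
      gˢᵃ∉H gˢᵃ∈H = g∉H (coprime-closed (coprime-^ˡ (prime∤⇒coprime s-prime s∤M′) a) gˢᵃ∈H g^M′∈H)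
    ...       | w , w∈⟨gˢᵃ⟩ , w∉H , primary = w , InCyc-trans w∈⟨gˢᵃ⟩ (pow-InCyc g (s ^ a)) , w∉H , primary

-- The quotient by a normal subgroup N keeps the carrier and coarsens the equality.
module Quotient {c ℓ h} (G : Group c ℓ) {N : Group.Carrier G → Set h}
                (N-normal : Subgroups.IsNormalSubgroup G N) where
  open Group G
  open Subgroups G using (pow; module IsNormalSubgroup)
  open IsNormalSubgroup N-normal
  open GroupSolver
  open Semantics G

  infix 4 _≈ᴺ_
  _≈ᴺ_ : Carrier → Carrier → Set h
  x ≈ᴺ y = N (x ⁻¹ ∙ y)

  ≈⇒≈ᴺ : ∀ {x y} → x ≈ y → x ≈ᴺ y
  ≈⇒≈ᴺ {x} x≈y = ≈-closed (trans (sym (inverseˡ x)) (∙-congˡ x≈y)) ε-closed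

  ≈ᴺ-sym : ∀ {x y} → x ≈ᴺ y → y ≈ᴺ x
  ≈ᴺ-sym {x} {y} x≈ᴺy =
    ≈-closed (solve ((x₀ ⁻ · x₁) ⁻) (x₁ ⁻ · x₀) ≡.refl (x ∷ y ∷ [])) (⁻¹-closed x≈ᴺy)

  ≈ᴺ-trans : ∀ {x y z} → x ≈ᴺ y → y ≈ᴺ z → x ≈ᴺ z
  ≈ᴺ-trans {x} {y} {z} x≈ᴺy y≈ᴺz =
    ≈-closed (solve ((x₀ ⁻ · x₁) · (x₁ ⁻ · x₂)) (x₀ ⁻ · x₂) ≡.refl (x ∷ y ∷ z ∷ []))
      (∙-closed x≈ᴺy y≈ᴺz)

  ∙-congᴺ : ∀ {x x′ y y′} → x ≈ᴺ x′ → y ≈ᴺ y′ → x ∙ y ≈ᴺ x′ ∙ y′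
  ∙-congᴺ {x} {x′} {y} {y′} x≈ᴺx′ y≈ᴺy′ =
    ≈-closed (solve ((x₂ ⁻ · (x₀ ⁻ · x₁) · x₂) · (x₂ ⁻ · x₃)) ((x₀ · x₂) ⁻ · (x₁ · x₃)) ≡.refl
                    (x ∷ x′ ∷ y ∷ y′ ∷ []))
      (∙-closed (conj-closed x≈ᴺx′ y) y≈ᴺy′)

  ⁻¹-congᴺ : ∀ {x y} → x ≈ᴺ y → x ⁻¹ ≈ᴺ y ⁻¹
  ⁻¹-congᴺ {x} {y} x≈ᴺy =
    ≈-closed (solve (x₀ ⁻ ⁻ · (x₀ ⁻ · x₁) ⁻ · x₀ ⁻) (x₀ ⁻ ⁻ · x₁ ⁻) ≡.refl (x ∷ y ∷ []))
      (conj-closed (⁻¹-closed x≈ᴺy) (x ⁻¹))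

  ≈ᴺε⇒∈ : ∀ {x} → x ≈ᴺ ε → N x
  ≈ᴺε⇒∈ {x} = ≈-closed (solve ((x₀ ⁻ · one) ⁻) x₀ ≡.refl (x ∷ [])) ∘ ⁻¹-closed

  ∈⇒≈ᴺε : ∀ {x} → N x → x ≈ᴺ ε
  ∈⇒≈ᴺε {x} = ≈-closed (solve (x₀ ⁻) (x₀ ⁻ · one) ≡.refl (x ∷ [])) ∘ ⁻¹-closed

  group : Group c h
  group = record
    { Carrier = Carrier
    ; _≈_     = _≈ᴺ_
    ; _∙_     = _∙_
    ; ε       = ε
    ; _⁻¹     = _⁻¹
    ; isGroup = record
      { isMonoid = record
        { isSemigroup = record
          { isMagma = record
            { isEquivalence = record { refl = ≈⇒≈ᴺ refl ; sym = ≈ᴺ-sym ; trans = ≈ᴺ-trans }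
            ; ∙-cong        = ∙-congᴺ
            }
          ; assoc = λ x y z → ≈⇒≈ᴺ (assoc x y z)
          }
        ; identity = (λ x → ≈⇒≈ᴺ (identityˡ x)) , (λ x → ≈⇒≈ᴺ (identityʳ x))
        }
      ; inverse = (λ x → ≈⇒≈ᴺ (inverseˡ x)) , (λ x → ≈⇒≈ᴺ (inverseʳ x))
      ; ⁻¹-cong = ⁻¹-congᴺ
      }
    }

  pow-quotient : ∀ x k → Subgroups.pow group x k ≡ pow x k
  pow-quotient x zero    = ≡.refl
  pow-quotient x (suc k) = ≡.cong (x ∙_) (pow-quotient x k)

  UpperCentral-quotient : ∀ i {x} → UpperCentral G i x → UpperCentral group i x
  UpperCentral-quotient zero    (lift x≈ε) = lift (≈⇒≈ᴺ x≈ε)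
  UpperCentral-quotient (suc i) x∈ζ        = λ g → UpperCentral-quotient i (x∈ζ g)

  group-nilpotent : IsNilpotent G → IsNilpotent group
  group-nilpotent (k , ζₖ≡G) = k , λ x → UpperCentral-quotient k (ζₖ≡G x)

module Nilpotent {c ℓ} (G : Group c ℓ) where
  open Group G
  open Subgroups G
  open GroupSolver
  open Semantics G
  open import Relation.Binary.Reasoning.Setoid setoid

  ⁅_,_⁆ : Carrier → Carrier → Carrier
  ⁅ x , g ⁆ = x ⁻¹ ∙ g ⁻¹ ∙ x ∙ g

  ⁅,⁆-cong : ∀ {x y g h} → x ≈ y → g ≈ h → ⁅ x , g ⁆ ≈ ⁅ y , h ⁆
  ⁅,⁆-cong x≈y g≈h = ∙-cong (∙-cong (∙-cong (⁻¹-cong x≈y) (⁻¹-cong g≈h)) x≈y) g≈h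

  ⁅,⁆≈ε⇒comm : ∀ {x y} → ⁅ x , y ⁆ ≈ ε → x ∙ y ≈ y ∙ x
  ⁅,⁆≈ε⇒comm {x} {y} ⁅x,y⁆≈ε = begin
    x ∙ y              ≈⟨ solve (x₀ · x₁) (x₁ · x₀ · (x₀ ⁻ · x₁ ⁻ · x₀ · x₁)) ≡.refl (x ∷ y ∷ []) ⟩
    y ∙ x ∙ ⁅ x , y ⁆  ≈⟨ ∙-congˡ ⁅x,y⁆≈ε ⟩
    y ∙ x ∙ ε          ≈⟨ identityʳ _ ⟩
    y ∙ x              ∎

  UpperCentral-isNormal : ∀ i → IsNormalSubgroup (UpperCentral G i)
  UpperCentral-isNormal zero = record
    { isSubgroup = record
      { ≈-closed  = λ x≈y → lift ∘ Trivial.≈-closed x≈y ∘ lower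
      ; ε-closed  = lift refl
      ; ∙-closed  = λ x≈ε y≈ε → lift (Trivial.∙-closed (lower x≈ε) (lower y≈ε))
      ; ⁻¹-closed = lift ∘ Trivial.⁻¹-closed ∘ lower
      }
    ; conj-closed = λ {x} x≈ε g → lift (begin
        g ⁻¹ ∙ x ∙ g  ≈⟨ ∙-congʳ (∙-congˡ (lower x≈ε)) ⟩
        g ⁻¹ ∙ ε ∙ g  ≈⟨ solve (x₀ ⁻ · one · x₀) one ≡.refl (g ∷ []) ⟩
        ε             ∎)
    }
  UpperCentral-isNormal (suc i) = record
    { isSubgroup = record
      { ≈-closed  = λ x≈y x∈ g → ≈-closed (⁅,⁆-cong x≈y refl) (x∈ g)
      ; ε-closed  = λ g → ≈-closed (solve one (one ⁻ · x₀ ⁻ · one · x₀) ≡.refl (g ∷ [])) ε-closed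
      ; ∙-closed  = λ {x} {y} x∈ y∈ g →
          ≈-closed (solve (x₁ ⁻ · (x₀ ⁻ · x₂ ⁻ · x₀ · x₂) · x₁ · (x₁ ⁻ · x₂ ⁻ · x₁ · x₂))
                          ((x₀ · x₁) ⁻ · x₂ ⁻ · (x₀ · x₁) · x₂) ≡.refl (x ∷ y ∷ g ∷ []))
            (∙-closed (conj-closed (x∈ g) y) (y∈ g))
      ; ⁻¹-closed = λ {x} x∈ g →
          ≈-closed (solve (x₀ ⁻ ⁻ · (x₀ ⁻ · x₁ ⁻ · x₀ · x₁) ⁻ · x₀ ⁻) (x₀ ⁻ ⁻ · x₁ ⁻ · x₀ ⁻ · x₁) ≡.refl
                          (x ∷ g ∷ []))
            (conj-closed (⁻¹-closed (x∈ g)) (x ⁻¹))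
      }
    ; conj-closed = λ {x} x∈ h g →
        ≈-closed (solve (x₁ ⁻ · (x₀ ⁻ · (x₁ · x₂ · x₁ ⁻) ⁻ · x₀ · (x₁ · x₂ · x₁ ⁻)) · x₁)
                        ((x₁ ⁻ · x₀ · x₁) ⁻ · x₂ ⁻ · (x₁ ⁻ · x₀ · x₁) · x₂) ≡.refl (x ∷ h ∷ g ∷ []))
          (conj-closed (x∈ (h ∙ g ∙ h ⁻¹)) h)
    }
    where open IsNormalSubgroup (UpperCentral-isNormal i)

  -- Modulo ζᵢ the commutator κ is central, and conjugation by y (resp. x) multiplies x (resp. y⁻¹) by κ;
  -- hence κ^b and κ^a vanish modulo ζᵢ.
  commutator-descends : ∀ i {x y a b} → pow x a ≈ ε → pow y b ≈ ε → Coprime a b →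
                        UpperCentral G (suc i) ⁅ x , y ⁆ → UpperCentral G i ⁅ x , y ⁆
  commutator-descends i {x} {y} {a} {b} xᵃ≈ε yᵇ≈ε a⊥b κ∈ζᵢ₊₁ =
    ≈ᴺε⇒∈ (H.Trivial.coprime-closed a⊥b
      (H.central-conjugation-pow≈ε {y ⁻¹} {x} {κ} {a} central x⁻¹y⁻¹x≈y⁻¹κ (powᴴ≈ε a xᵃ≈ε))
      (H.central-conjugation-pow≈ε {x} {y} {κ} {b} central (≈⇒≈ᴺ y⁻¹xy≈xκ) (powᴴ≈ε b yᵇ≈ε)))
    where
    open Quotient G (UpperCentral-isNormal i)
    open IsNormalSubgroup (UpperCentral-isNormal i) using (≈-closed; ⁻¹-closed)
    module H = Subgroups group
    κ : Carrier
    κ = ⁅ x , y ⁆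
    central : ∀ g → κ ∙ g ≈ᴺ g ∙ κ
    central g = ≈-closed (solve ((x₀ ⁻ · x₁ ⁻ · x₀ · x₁) ⁻) ((x₀ · x₁) ⁻ · (x₁ · x₀)) ≡.refl (κ ∷ g ∷ []))
                  (⁻¹-closed (κ∈ζᵢ₊₁ g))
    y⁻¹xy≈xκ : y ⁻¹ ∙ x ∙ y ≈ x ∙ κ
    y⁻¹xy≈xκ = solve (x₁ ⁻ · x₀ · x₁) (x₀ · (x₀ ⁻ · x₁ ⁻ · x₀ · x₁)) ≡.refl (x ∷ y ∷ [])
    x⁻¹y⁻¹x≈y⁻¹κ : x ⁻¹ ∙ y ⁻¹ ∙ x ≈ᴺ y ⁻¹ ∙ κ
    x⁻¹y⁻¹x≈y⁻¹κ = ≈ᴺ-trans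
      (≈⇒≈ᴺ (solve (x₀ ⁻ · x₁ ⁻ · x₀) ((x₀ ⁻ · x₁ ⁻ · x₀ · x₁) · x₁ ⁻) ≡.refl (x ∷ y ∷ [])))
      (central (y ⁻¹))
    powᴴ≈ε : ∀ {u} k → pow u k ≈ ε → H.pow u k ≈ᴺ ε
    powᴴ≈ε {u} k uᵏ≈ε = ≡.subst (_≈ᴺ ε) (≡.sym (pow-quotient u k)) (≈⇒≈ᴺ uᵏ≈ε)

  coprime-orders-commute : IsNilpotent G → ∀ {x y a b} → pow x a ≈ ε → pow y b ≈ ε → Coprime a b →
                           x ∙ y ≈ y ∙ x
  coprime-orders-commute (k , ζₖ≡G) {x} {y} xᵃ≈ε yᵇ≈ε a⊥b =
    ⁅,⁆≈ε⇒comm (lower (descend k (ζₖ≡G ⁅ x , y ⁆)))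
    where
    descend : ∀ i → UpperCentral G i ⁅ x , y ⁆ → UpperCentral G 0 ⁅ x , y ⁆
    descend zero    = id
    descend (suc i) = descend i ∘ commutator-descends i xᵃ≈ε yᵇ≈ε a⊥b

CauchyFor : ∀ c ℓ → ℕ → Set (Level.suc (c ⊔ ℓ))
CauchyFor c ℓ n = (G : Group c ℓ) → HasOrder G n → IsNilpotent G →
                  ∀ {t} → Prime t → t ∣ n → Subgroups.HasElementOfOrder G t

module Finite {c ℓ} (G : Group c ℓ) {n} (order : HasOrder G n) where
  open Group G
  open Subgroups G
  open CyclicSubgroups G
  open Nilpotent G using (⁅_,_⁆; ⁅,⁆-cong; ⁅,⁆≈ε⇒comm)
  open import Algebra.Properties.Group G using (identityʳ-unique; ∙-cancelˡ)
  open import Relation.Binary.Reasoning.Setoid setoid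

  private
    element : Fin n → Carrier
    element = proj₁ order

    element-injective : ∀ i j → element i ≈ element j → i ≡ j
    element-injective = proj₁ (proj₂ order)

    index : Carrier → Fin n
    index x = proj₁ (proj₂ (proj₂ order) x)

    element-index : ∀ x → element (index x) ≈ x
    element-index x = proj₂ (proj₂ (proj₂ order) x)

  index-injective : ∀ {x y} → index x ≡ index y → x ≈ y
  index-injective {x} {y} same = trans (sym (element-index x)) (trans (reflexive (≡.cong element same)) (element-index y))

  infix 4 _≟_
  _≟_ : ∀ x y → Dec (x ≈ y)
  x ≟ y with index x Fin.≟ index y
  ... | yes same = yes (index-injective same)
  ... | no  diff = no λ x≈y → diff (element-injective _ _ (trans (element-index x) (trans x≈y (sym (element-index y)))))

  ∃? : ∀ {p} {P : Carrier → Set p} → (∀ {x y} → x ≈ y → P x → P y) → (∀ x → Dec (P x)) → Dec (∃ P)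
  ∃? P-resp P? with any? (λ i → P? (element i))
  ... | yes (i , Pi) = yes (element i , Pi)
  ... | no  ∄i       = no λ (x , Px) → ∄i (index x , P-resp (sym (element-index x)) Px)

  ∀? : ∀ {p} {P : Carrier → Set p} → (∀ {x y} → x ≈ y → P x → P y) → (∀ x → Dec (P x)) → Dec (∀ x → P x)
  ∀? P-resp P? with all? (λ i → P? (element i))
  ... | yes ∀i = yes λ x → P-resp (element-index x) (∀i (index x))
  ... | no  ¬∀i = no λ ∀x → ¬∀i (λ i → ∀x (element i))

  order-unique : ∀ {m} → HasOrder G m → n ≡ m
  order-unique (element′ , element′-injective , surjective′) = cantor-schröder-bernstein
    (λ {i} {j} same → element-injective i j (trans (sym (proj₂ (surjective′ (element i))))
                                             (trans (reflexive (≡.cong element′ same)) (proj₂ (surjective′ (element j))))))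
    (λ {i} {j} same → element′-injective i j (trans (sym (element-index (element′ i)))
                                             (trans (reflexive (≡.cong element same)) (element-index (element′ j)))))

  positive-exponent : ∀ x → ∃ λ N → pow x (suc N) ≈ ε
  positive-exponent x with pigeonhole (n<1+n n) (λ i → index (pow x (toℕ i)))
  ... | i , j , i<j , same with m≤n⇒∃[o]m+o≡n i<j
  ...   | o , 1+i+o≡j = o , identityʳ-unique (pow x (toℕ i)) (pow x (suc o)) (begin
    pow x (toℕ i) ∙ pow x (suc o)  ≈⟨ ×-homo-+ x (toℕ i) (suc o) ⟨
    pow x (toℕ i + suc o)          ≡⟨ ≡.cong (pow x) (≡.trans (+-suc (toℕ i) o) 1+i+o≡j) ⟩
    pow x (toℕ j)                  ≈⟨ index-injective same ⟨
    pow x (toℕ i)                  ∎)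

  power? : ∀ x g → Dec (∃ λ k → x ≈ pow g k)
  power? x g with positive-exponent g
  ... | N , gᴺ≈ε with any? (λ (r : Fin (suc N)) → x ≟ pow g (toℕ r))
  ...   | yes (r , x≈gʳ) = yes (toℕ r , x≈gʳ)
  ...   | no  ∄r         = no λ (k , x≈gᵏ) →
    let r , gᵏ≈gʳ = pow-residue gᴺ≈ε k in ∄r (r , trans x≈gᵏ gᵏ≈gʳ)

  InCyc? : ∀ x g → Dec (InCyc G x g)
  InCyc? x g with power? x g | positive-exponent g
  ... | yes (k , x≈gᵏ) | _          = yes (resp (sym x≈gᵏ) (pow-InCyc g k))
  ... | no  ∄k         | N , gᴺ≈ε = no λ x∈⟨g⟩ → ∄k (InCyc⇒pow {N = N} gᴺ≈ε x∈⟨g⟩)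

  ∃-prime-order-power : ∀ {x} → ¬ x ≈ ε → ∃₂ λ j r → Prime r × ¬ pow x j ≈ ε × pow (pow x j) r ≈ ε
  ∃-prime-order-power {x} x≉ε with positive-exponent x
  ... | N , x^[1+N]≈ε = <-rec P step (suc N) x^[1+N]≈ε
    where
    P : ℕ → Set _
    P M = .{{NonZero M}} → pow x M ≈ ε → ∃₂ λ j r → Prime r × ¬ pow x j ≈ ε × pow (pow x j) r ≈ ε
    step : ∀ M → (∀ {K} → K < M → P K) → P M
    step (suc zero) rec x¹≈ε = ⊥-elim (x≉ε (trans (sym (×-homo-1 x)) x¹≈ε))
    step M@(suc (suc _)) rec xᴹ≈ε with ∃-prime∣ M
    ... | r , r-prime , r∣M with pow x (quotient r∣M) ≟ ε
    ...   | no  xᵠ≉ε = quotient r∣M , r , r-prime , xᵠ≉ε , (begin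
      pow (pow x (quotient r∣M)) r  ≈⟨ ×-assocˡ x r (quotient r∣M) ⟩
      pow x (r * quotient r∣M)      ≡⟨ ≡.cong (pow x) (m∣n⇒n≡m*quotient r∣M) ⟨
      pow x M                       ≈⟨ xᴹ≈ε ⟩
      ε                             ∎)
    ...   | yes xᵠ≈ε = rec (quotient-< r∣M {{prime⇒nonTrivial r-prime}}) {{quotient≢0 r∣M}} xᵠ≈ε

  ∃-nontrivial : 1 < n → ∃ λ x → ¬ x ≈ ε
  ∃-nontrivial (s≤s (s≤s _)) with element zero ≟ ε
  ... | no  x₀≉ε = element zero , x₀≉ε
  ... | yes x₀≈ε = element (suc zero) , λ x₁≈ε → 0≢1 (element-injective _ _ (trans x₀≈ε (sym x₁≈ε)))
    where
    0≢1 : ∀ {m} → Fin.zero {suc m} ≢ Fin.suc Fin.zero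
    0≢1 ()

  order-nonZero : NonZero n
  order-nonZero = ℕ.>-nonZero (m<n⇒0<n (toℕ<n (index ε)))

  -- Were no nontrivial element central, every ζᵢ would be trivial, while ζₖ = G is not.
  nontrivial-centre : IsNilpotent G → 1 < n → ∃ λ z → (∀ g → z ∙ g ≈ g ∙ z) × ¬ z ≈ ε
  nontrivial-centre (k , ζₖ≡G) 1<n with ∃? Central-resp Central?
    where
    Central : Carrier → Set (c ⊔ ℓ)
    Central z = (∀ g → ⁅ z , g ⁆ ≈ ε) × ¬ z ≈ ε
    Central? : ∀ z → Dec (Central z)
    Central? z = ∀? (λ g≈h → trans (⁅,⁆-cong refl (sym g≈h))) (λ g → ⁅ z , g ⁆ ≟ ε) ×-dec ¬? (z ≟ ε)
    Central-resp : ∀ {x y} → x ≈ y → Central x → Central y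
    Central-resp x≈y (x-central , x≉ε) =
      (λ g → trans (⁅,⁆-cong (sym x≈y) refl) (x-central g)) , λ y≈ε → x≉ε (trans x≈y y≈ε)
  ... | yes (z , z-central , z≉ε) = z , (λ g → ⁅,⁆≈ε⇒comm (z-central g)) , z≉ε
  ... | no  no-centre with ∃-nontrivial 1<n
  ...   | x , x≉ε = ⊥-elim (x≉ε (trivial k x (ζₖ≡G x)))
    where
    trivial : ∀ i x → UpperCentral G i x → x ≈ ε
    trivial zero    x (lift x≈ε) = x≈ε
    trivial (suc i) x x∈ζ with x ≟ ε
    ... | yes x≈ε = x≈ε
    ... | no  x≉ε = ⊥-elim (no-centre (x , (λ g → trivial i _ (x∈ζ g)) , x≉ε))

  -- Each coset is represented by its element of least index.
  quotient-finite : ∀ {h} {N : Carrier → Set h} (N-normal : IsNormalSubgroup N) → (∀ x → Dec (N x)) →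
                    ∃ λ m → HasOrder (Quotient.group G N-normal) m
  quotient-finite {h} N-normal N? = size , element ∘ at , injective , surjective
    where
    open Quotient G N-normal
    _≈ᴺ?_ : ∀ x y → Dec (x ≈ᴺ y)
    x ≈ᴺ? y = N? (x ⁻¹ ∙ y)
    Representative : Fin n → Set h
    Representative i = ∀ j → j Fin.< i → ¬ element j ≈ᴺ element i
    open Enumeration (enumerate {P = Representative} λ i → all? λ j → (j Fin.<? i) →-dec ¬? (element j ≈ᴺ? element i))
    representatives-unique : ∀ {i j} → Representative i → Representative j → element i ≈ᴺ element j → i ≡ j
    representatives-unique {i} {j} rep-i rep-j i≈ᴺj with <-cmp i j
    ... | tri< i<j _ _ = ⊥-elim (rep-j i i<j i≈ᴺj)
    ... | tri≈ _ i≡j _ = i≡j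
    ... | tri> _ _ j<i = ⊥-elim (rep-i j j<i (≈ᴺ-sym i≈ᴺj))
    injective : ∀ a b → element (at a) ≈ᴺ element (at b) → a ≡ b
    injective a b same = at-injective (representatives-unique (at-satisfies a) (at-satisfies b) same)
    surjective : ∀ x → ∃ λ a → element (at a) ≈ᴺ x
    surjective x with least (λ i → element i ≈ᴺ? x) (≈⇒≈ᴺ (element-index x))
    ... | i , i≈ᴺx , below-i with at-surjective {i} (λ j j<i j≈ᴺi → below-i j j<i (≈ᴺ-trans j≈ᴺi i≈ᴺx))
    ...   | a , ≡.refl = a , i≈ᴺx

  module CentralQuotient {z R} (z-central : ∀ g → z ∙ g ≈ g ∙ z) (z^r≈ε : pow z (suc R) ≈ ε)
                         (z≉ε : ¬ z ≈ ε) (r-prime : Prime (suc R)) where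
    open GroupSolver
    open Semantics G

    -- ⟨z⟩ as explicit powers, which keeps the quotient's equality at level ℓ.
    Power : Carrier → Set ℓ
    Power w = ∃ λ k → w ≈ pow z k

    Power-normal : IsNormalSubgroup Power
    Power-normal = record
      { isSubgroup = record
        { ≈-closed  = λ x≈y (k , x≈zᵏ) → k , trans (sym x≈y) x≈zᵏ
        ; ε-closed  = 0 , refl
        ; ∙-closed  = λ (i , x≈zⁱ) (j , y≈zʲ) → i + j , trans (∙-cong x≈zⁱ y≈zʲ) (sym (×-homo-+ z i j))
        ; ⁻¹-closed = λ (i , x≈zⁱ) → i * R , trans (⁻¹-cong x≈zⁱ) (pow-inverse z^r≈ε i)
        }
      ; conj-closed = λ {x} (k , x≈zᵏ) g → k , (begin
          g ⁻¹ ∙ x ∙ g   ≈⟨ assoc _ _ _ ⟩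
          g ⁻¹ ∙ (x ∙ g) ≈⟨ ∙-congˡ (trans (∙-congʳ x≈zᵏ)
                                   (trans (pow-comm (z-central g) k) (∙-congˡ (sym x≈zᵏ)))) ⟩
          g ⁻¹ ∙ (g ∙ x) ≈⟨ solve (x₀ ⁻ · (x₀ · x₁)) x₁ ≡.refl (g ∷ x ∷ []) ⟩
          x              ≈⟨ x≈zᵏ ⟩
          pow z k        ∎)
      }

    open Quotient G Power-normal public
    module Power = IsNormalSubgroup Power-normal

    pow-distinct-below : ∀ {a b} → a < b → b < suc R → ¬ pow z a ≈ pow z b
    pow-distinct-below {a} {b} a<b b<r zᵃ≈zᵇ with m≤n⇒∃[o]m+o≡n a<b
    ... | o , 1+a+o≡b = z≉ε (Trivial.coprime-closed (prime⇒coprime r-prime 1+o<r) z^r≈ε z^[1+o]≈ε)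
      where
      a+1+o≡b : a + suc o ≡ b
      a+1+o≡b = ≡.trans (+-suc a o) 1+a+o≡b
      1+o<r : suc o < suc R
      1+o<r = ≤-<-trans (≡.subst (suc o ≤_) a+1+o≡b (m≤n+m (suc o) a)) b<r
      z^[1+o]≈ε : pow z (suc o) ≈ ε
      z^[1+o]≈ε = identityʳ-unique (pow z a) (pow z (suc o)) (begin
        pow z a ∙ pow z (suc o)  ≈⟨ ×-homo-+ z a (suc o) ⟨
        pow z (a + suc o)        ≡⟨ ≡.cong (pow z) a+1+o≡b ⟩
        pow z b                  ≈⟨ zᵃ≈zᵇ ⟨
        pow z a                  ∎)

    powers-distinct : ∀ (i j : Fin (suc R)) → pow z (toℕ i) ≈ pow z (toℕ j) → i ≡ j
    powers-distinct i j zⁱ≈zʲ with <-cmp i j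
    ... | tri< i<j _ _ = ⊥-elim (pow-distinct-below i<j (toℕ<n j) zⁱ≈zʲ)
    ... | tri≈ _ i≡j _ = i≡j
    ... | tri> _ _ j<i = ⊥-elim (pow-distinct-below j<i (toℕ<n i) (sym zⁱ≈zʲ))

    -- Every element is uniquely a coset representative times a power z^j with j < r.
    coset-decomposition : ∀ {m} → HasOrder group m → HasOrder G (m * suc R)
    coset-decomposition {m} (rep , rep-injective , rep-surjective) =
      Ψ ∘ remQuot (suc R) , Ψ∘remQuot-injective , Ψ∘remQuot-surjective
      where
      Ψ : Fin m × Fin (suc R) → Carrier
      Ψ (a , j) = rep a ∙ pow z (toℕ j)
      Ψ-injective : ∀ p q → Ψ p ≈ Ψ q → p ≡ q
      Ψ-injective (a , j) (b , k) Ψ≈Ψ with rep-injective a b (Power.≈-closed (begin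
          Z j ∙ Z k ⁻¹                       ≈⟨ solve (x₂ · x₃ ⁻) (x₀ ⁻ · (x₀ · x₂) · x₃ ⁻) ≡.refl ρ ⟩
          rep a ⁻¹ ∙ (rep a ∙ Z j) ∙ Z k ⁻¹  ≈⟨ ∙-congʳ (∙-congˡ Ψ≈Ψ) ⟩
          rep a ⁻¹ ∙ (rep b ∙ Z k) ∙ Z k ⁻¹  ≈⟨ solve (x₀ ⁻ · (x₁ · x₃) · x₃ ⁻) (x₀ ⁻ · x₁) ≡.refl ρ ⟩
          rep a ⁻¹ ∙ rep b                      ∎)
        (Power.∙-closed (toℕ j , refl) (Power.⁻¹-closed (toℕ k , refl))))
        where
        Z : Fin (suc R) → Carrier
        Z i = pow z (toℕ i)
        ρ : Vec Carrier 4
        ρ = rep a ∷ rep b ∷ Z j ∷ Z k ∷ []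
      ... | ≡.refl = ≡.cong (a ,_) (powers-distinct j k (∙-cancelˡ (rep a) _ _ Ψ≈Ψ))
      Ψ-surjective : ∀ x → ∃ λ p → Ψ p ≈ x
      Ψ-surjective x with rep-surjective x
      ... | a , k , rep⁻¹x≈zᵏ with pow-residue z^r≈ε k
      ...   | j , zᵏ≈zʲ = (a , j) , (begin
        rep a ∙ pow z (toℕ j)      ≈⟨ ∙-congˡ (trans (sym zᵏ≈zʲ) (sym rep⁻¹x≈zᵏ)) ⟩
        rep a ∙ (rep a ⁻¹ ∙ x)     ≈⟨ solve (x₀ · (x₀ ⁻ · x₁)) x₁ ≡.refl (rep a ∷ x ∷ []) ⟩
        x                          ∎)
      Ψ∘remQuot-injective : ∀ i i′ → Ψ (remQuot (suc R) i) ≈ Ψ (remQuot (suc R) i′) → i ≡ i′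
      Ψ∘remQuot-injective i i′ Ψ≈Ψ = ≡.trans (≡.sym (combine-remQuot {m} (suc R) i))
        (≡.trans (≡.cong (uncurry combine) (Ψ-injective _ _ Ψ≈Ψ)) (combine-remQuot {m} (suc R) i′))
      Ψ∘remQuot-surjective : ∀ x → ∃ λ i → Ψ (remQuot (suc R) i) ≈ x
      Ψ∘remQuot-surjective x with Ψ-surjective x
      ... | (a , j) , Ψ≈x = combine a j , trans (reflexive (≡.cong Ψ (remQuot-combine a j))) Ψ≈x

    Power⇒pow≈ε : ∀ {w} → Power w → pow w (suc R) ≈ ε
    Power⇒pow≈ε {w} (k , w≈zᵏ) = begin
      pow w (suc R)          ≈⟨ ×-congʳ (suc R) w≈zᵏ ⟩
      pow (pow z k) (suc R)  ≈⟨ ×-assocˡ z (suc R) k ⟩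
      pow z (suc R * k)      ≡⟨ ≡.cong (pow z) (*-comm (suc R) k) ⟩
      pow z (k * suc R)      ≈⟨ pow-*≈ε z^r≈ε k ⟩
      ε                      ∎

    lift-element : ∀ {t} → Prime t → t ≢ suc R → Subgroups.HasElementOfOrder group t → HasElementOfOrder t
    lift-element {t} t-prime t≢r (u , u≉ᴺε , uᵗ≈ᴺε) = pow u (suc R) , uʳ≉ε , uʳᵗ≈ε
      where
      uᵗ∈⟨z⟩ : Power (pow u t)
      uᵗ∈⟨z⟩ = ≈ᴺε⇒∈ (≡.subst (_≈ᴺ ε) (pow-quotient u t) uᵗ≈ᴺε)
      uʳᵗ≈ε : pow (pow u (suc R)) t ≈ ε
      uʳᵗ≈ε = begin
        pow (pow u (suc R)) t  ≈⟨ ×-assocˡ u t (suc R) ⟩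
        pow u (t * suc R)      ≡⟨ ≡.cong (pow u) (*-comm t (suc R)) ⟩
        pow u (suc R * t)      ≈⟨ ×-assocˡ u (suc R) t ⟨
        pow (pow u t) (suc R)  ≈⟨ Power⇒pow≈ε uᵗ∈⟨z⟩ ⟩
        ε                      ∎
      uʳ≉ε : ¬ pow u (suc R) ≈ ε
      uʳ≉ε uʳ≈ε =
        u≉ᴺε (∈⇒≈ᴺε (Power.coprime-closed (distinct-primes⇒coprime t-prime r-prime t≢r) uᵗ∈⟨z⟩ (0 , uʳ≈ε)))

    element-of-order : IsNilpotent G → (∀ {m} → m < n → CauchyFor c ℓ m) →
                       ∀ {t} → Prime t → t ∣ n → t ≢ suc R → HasElementOfOrder t
    element-of-order nilpotent smaller {t} t-prime t∣n t≢r = from-quotient (quotient-finite Power-normal (λ w → power? w z))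
      where
      from-quotient : (∃ λ m → HasOrder group m) → HasElementOfOrder t
      from-quotient (m , Q-order) =
        lift-element t-prime t≢r (smaller m<n group Q-order (group-nilpotent nilpotent) t-prime t∣m)
        where
        n≡mr : n ≡ m * suc R
        n≡mr = order-unique (coset-decomposition Q-order)
        t∣m : t ∣ m
        t∣m with euclidsLemma m (suc R) t-prime (≡.subst (t ∣_) n≡mr t∣n)
        ... | inj₁ t∣m = t∣m
        ... | inj₂ t∣r = ⊥-elim (¬prime[1] (≡.subst Prime t≡1 t-prime))
          where
          t≡1 : t ≡ 1
          t≡1 = distinct-primes⇒coprime t-prime r-prime t≢r (∣-refl , t∣r)
        m≢0 : NonZero m
        m≢0 = ≢-nonZero λ { ≡.refl → ℕ.≢-nonZero⁻¹ n {{order-nonZero}} n≡mr }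
        m<n : m < n
        m<n = ≡.subst (m <_) (≡.sym n≡mr) (m<m*n m (suc R) {{m≢0}} (nonTrivial⇒n>1 (suc R) {{prime⇒nonTrivial r-prime}}))

  -- Take a central z of prime order r; if r ≠ t, an element of order t in G / ⟨z⟩ lifts to one in G.
  cauchy-step : IsNilpotent G → (∀ {m} → m < n → CauchyFor c ℓ m) → ∀ {t} → Prime t → t ∣ n → HasElementOfOrder t
  cauchy-step nilpotent smaller {t} t-prime t∣n = from-centre (nontrivial-centre nilpotent 1<n)
    where
    1<n : 1 < n
    1<n = ≤-trans (nonTrivial⇒n>1 t {{prime⇒nonTrivial t-prime}}) (∣⇒≤ {{order-nonZero}} t∣n)
    from-prime-order-power : ∀ {z} → (∀ g → z ∙ g ≈ g ∙ z) →
      (∃₂ λ j r → Prime r × ¬ pow z j ≈ ε × pow (pow z j) r ≈ ε) → HasElementOfOrder t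
    from-prime-order-power _ (_ , zero , 0-prime , _) = ⊥-elim (¬prime[0] 0-prime)
    from-prime-order-power {z} z-central (j , suc R , r-prime , zʲ≉ε , zʲʳ≈ε) with suc R ℕ.≟ t
    ... | yes ≡.refl = pow z j , zʲ≉ε , zʲʳ≈ε
    ... | no  r≢t    = CentralQuotient.element-of-order (λ g → pow-comm (z-central g) j) zʲʳ≈ε zʲ≉ε r-prime
                         nilpotent smaller t-prime t∣n (≡.≢-sym r≢t)
    from-centre : (∃ λ z → (∀ g → z ∙ g ≈ g ∙ z) × ¬ z ≈ ε) → HasElementOfOrder t
    from-centre (z , z-central , z≉ε) = from-prime-order-power z-central (∃-prime-order-power z≉ε)

cauchy : ∀ {c ℓ} n → CauchyFor c ℓ n
cauchy {c} {ℓ} = <-rec (CauchyFor c ℓ) λ n smaller G order nilpotent → Finite.cauchy-step G order nilpotent smaller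

module DifferenceGraph {c ℓ} (G : Group c ℓ) {n} (order : HasOrder G n) (nilpotent : IsNilpotent G)
                       (not-prime-power : ∀ p → Prime p → ¬ (∃ λ k → n ≡ p ^ k)) where
  open Group G
  open Subgroups G
  open CyclicSubgroups G
  open Finite G order
  open Nilpotent G using (coprime-orders-commute)

  -- Existential results are taken apart by helper functions (from-…): with `let` or `with` their proof
  -- terms reach the unifier, which normalises them through factorisation and Cauchy's recursion.

  coprime-orders⇒DAdj : ∀ {a b M N} → ¬ a ≈ ε → ¬ b ≈ ε → pow a M ≈ ε → pow b N ≈ ε → Coprime M N → DAdj G a b
  coprime-orders⇒DAdj a≉ε b≉ε aᴹ≈ε bᴺ≈ε M⊥N =
    coprime-commuting⇒DAdj a≉ε b≉ε (coprime-orders-commute nilpotent aᴹ≈ε bᴺ≈ε M⊥N) aᴹ≈ε bᴺ≈ε M⊥N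

  element-of-other-prime-order : ∀ {s} → Prime s → ∃ λ t → Prime t × t ≢ s × HasElementOfOrder (t ^ 1)
  element-of-other-prime-order {s} s-prime = from-divisor (∃-prime∣≢ n s {{order-nonZero}} (not-prime-power s s-prime))
    where
    from-divisor : (∃ λ t → Prime t × t ∣ n × t ≢ s) → ∃ λ t → Prime t × t ≢ s × HasElementOfOrder (t ^ 1)
    from-divisor (t , t-prime , t∣n , t≢s) = t , t-prime , t≢s , as-power-of-prime (cauchy n G order nilpotent t-prime t∣n)
      where
      as-power-of-prime : HasElementOfOrder t → HasElementOfOrder (t ^ 1)
      as-power-of-prime (u , u≉ε , uᵗ≈ε) = u , u≉ε , trans (reflexive (≡.cong (pow u) (^-identityʳ t))) uᵗ≈ε

  DVertex⇒nontrivial : ∀ {x} → DVertex G x → ¬ x ≈ ε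
  DVertex⇒nontrivial (_ , _ , x∉⟨y⟩ , _) x≈ε = x∉⟨y⟩ (≈ε⇒InCyc x≈ε)

  ∃-primary-cyclic-partner : ∀ {x} → DVertex G x → ∃ λ w → IsCyclic G (Gen2 G x w) × ¬ InCyc G w x × IsPrimary w
  ∃-primary-cyclic-partner {x} (y , (z , _ , ⟨x,y⟩⊆⟨z⟩) , _ , y∉⟨x⟩) = from-exponent (positive-exponent z)
    where
    z∉⟨x⟩ : ¬ InCyc G z x
    z∉⟨x⟩ z∈⟨x⟩ = y∉⟨x⟩ (InCyc-trans (⟨x,y⟩⊆⟨z⟩ y (gen (inj₂ refl))) z∈⟨x⟩)
    from-exponent : (∃ λ N → pow z (suc N) ≈ ε) → ∃ λ w → IsCyclic G (Gen2 G x w) × ¬ InCyc G w x × IsPrimary w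
    from-exponent (N , z^[1+N]≈ε) =
      from-component (∃-primary-outside Gen-isSubgroup (λ w → InCyc? w x) (suc N) z^[1+N]≈ε z∉⟨x⟩)
      where
      powers-of-z : ∀ {w} → InCyc G w z → ∃ λ k → w ≈ pow z k
      powers-of-z = InCyc⇒pow {N = N} z^[1+N]≈ε
      from-component : (∃ λ w → InCyc G w z × ¬ InCyc G w x × IsPrimary w) →
                       ∃ λ w → IsCyclic G (Gen2 G x w) × ¬ InCyc G w x × IsPrimary w
      from-component (w , w∈⟨z⟩ , w∉⟨x⟩ , w-primary)
        with powers-of-z (⟨x,y⟩⊆⟨z⟩ x (gen (inj₁ refl))) | powers-of-z w∈⟨z⟩
      ... | k , x≈zᵏ | l , w≈zˡ = w , powers-generate-cyclic {z = z} {k} {l} x≈zᵏ w≈zˡ , w∉⟨x⟩ , w-primary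

  record PrimaryNeighbour (x : Carrier) : Set (c ⊔ ℓ) where
    constructor primaryNeighbour
    field
      h         : Carrier
      h≉ε       : ¬ h ≈ ε
      h-primary : IsPrimary h
      adjacent  : DAdj G x h

  ∃-primary-neighbour : ∀ {x} → DVertex G x → PrimaryNeighbour x
  ∃-primary-neighbour {x} x-vertex = from-partner (∃-primary-cyclic-partner x-vertex)
    where
    from-partner : (∃ λ w → IsCyclic G (Gen2 G x w) × ¬ InCyc G w x × IsPrimary w) → PrimaryNeighbour x
    from-partner (w , ⟨x,w⟩-cyclic , w∉⟨x⟩ , w-primary@(p , e , p-prime , wᵖᵉ≈ε)) with InCyc? x w
    ... | no  x∉⟨w⟩ = primaryNeighbour w (w∉⟨x⟩ ∘ ≈ε⇒InCyc) w-primary (⟨x,w⟩-cyclic , x∉⟨w⟩ , w∉⟨x⟩)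
    ... | yes x∈⟨w⟩ = from-other-prime (element-of-other-prime-order p-prime)
      where
      from-other-prime : (∃ λ t → Prime t × t ≢ p × HasElementOfOrder (t ^ 1)) → PrimaryNeighbour x
      from-other-prime (t , t-prime , t≢p , u , u≉ε , uᵗ≈ε) =
        primaryNeighbour u u≉ε (t , 1 , t-prime , uᵗ≈ε)
          (coprime-orders⇒DAdj (DVertex⇒nontrivial x-vertex) u≉ε (InCyc⇒pow≈ε (p ^ e) wᵖᵉ≈ε x∈⟨w⟩) uᵗ≈ε
                               (prime-powers-coprime p-prime t-prime (≡.≢-sym t≢p) e 1))

  walk≤4 : ∀ x y → DVertex G x → DVertex G y → ∃ λ m → m ≤ 4 × DWalk G m x y
  walk≤4 x y x-vertex y-vertex = join (∃-primary-neighbour x-vertex) (∃-primary-neighbour y-vertex)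
    where
    join : PrimaryNeighbour x → PrimaryNeighbour y → ∃ λ m → m ≤ 4 × DWalk G m x y
    join (primaryNeighbour hx hx≉ε (p , e , p-prime , hxᵖᵉ≈ε) x~hx)
         (primaryNeighbour hy hy≉ε (q , f , q-prime , hyᑫᶠ≈ε) y~hy) with p ℕ.≟ q
    ... | no  p≢q = 3 , s≤s (s≤s (s≤s z≤n)) , cons x~hx (cons hx~hy (cons (DAdj-sym y~hy) (nil refl)))
      where
      hx~hy : DAdj G hx hy
      hx~hy = coprime-orders⇒DAdj hx≉ε hy≉ε hxᵖᵉ≈ε hyᑫᶠ≈ε (prime-powers-coprime p-prime q-prime p≢q e f)
    ... | yes ≡.refl = via-other-prime (element-of-other-prime-order p-prime)
      where
      via-other-prime : (∃ λ t → Prime t × t ≢ p × HasElementOfOrder (t ^ 1)) → ∃ λ m → m ≤ 4 × DWalk G m x y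
      via-other-prime (t , t-prime , t≢p , u , u≉ε , uᵗ≈ε) = 4 , ≤-refl ,
        cons x~hx (cons hx~u (cons u~hy (cons (DAdj-sym y~hy) (nil refl))))
        where
        hx~u : DAdj G hx u
        hx~u = coprime-orders⇒DAdj hx≉ε u≉ε hxᵖᵉ≈ε uᵗ≈ε (prime-powers-coprime p-prime t-prime (≡.≢-sym t≢p) e 1)
        u~hy : DAdj G u hy
        u~hy = coprime-orders⇒DAdj u≉ε hy≉ε uᵗ≈ε hyᑫᶠ≈ε (prime-powers-coprime t-prime p-prime t≢p 1 f)

  ∃-vertex : ∃ λ x → DVertex G x
  ∃-vertex = from-prime (element-of-other-prime-order prime[2])
    where
    from-prime : (∃ λ p → Prime p × p ≢ 2 × HasElementOfOrder (p ^ 1)) → ∃ λ x → DVertex G x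
    from-prime (p , p-prime , _ , up , up≉ε , upᵖ≈ε) = from-other-prime (element-of-other-prime-order p-prime)
      where
      from-other-prime : (∃ λ t → Prime t × t ≢ p × HasElementOfOrder (t ^ 1)) → ∃ λ x → DVertex G x
      from-other-prime (t , t-prime , t≢p , ut , ut≉ε , utᵗ≈ε) =
        up , ut , coprime-orders⇒DAdj up≉ε ut≉ε upᵖ≈ε utᵗ≈ε
                                        (prime-powers-coprime p-prime t-prime (≡.≢-sym t≢p) 1 1)

theorem3p3 : ∀ {c ℓ : Level} (G : Group c ℓ) (n : ℕ) →
    HasOrder G n →
    IsNilpotent G →
    (∀ p → Prime p → ¬ (∃ λ k → n ≡ p ^ k)) →
    (∃ λ x → DVertex G x) ×
    (∀ x y → DVertex G x → DVertex G y → ∃ λ m → m ≤ 4 × DWalk G m x y)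
theorem3p3 G n order nilpotent not-prime-power = ∃-vertex , walk≤4
  where open DifferenceGraph G order nilpotent not-prime-power
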